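{- Let $(n_k)_{k\in\mathbb{N}}$ be an increasing sequence of natural numbers such that for all $\alpha,\beta,\gamma\in\mathcal F$, $$\sum_{j\in\alpha}n_j+\sum_{j\in\beta}n_j=\sum_{j\in\gamma}n_j\quad\text{if and only if}\quad \alpha\cup\beta=\gamma\text{ and }\alpha\cap\beta=\emptyset.$$ Then for every $\ell\ge2$, the set $\mathrm{FS}((n_k)_{k\in\mathbb{N}})$ is not a $\Delta_{\ell,\,14\cdot 2^{\ell-2}}$ set.
   Context: $\mathbb{N}=\{1,2,\dots\}$; $\mathcal F$ is the set of all finite non-empty subsets of $\mathbb{N}$. $\mathrm{FS}((n_k)_{k\in\mathbb{N}})=\{n_{k_1}+\dots+n_{k_m}:k_1<\dots<k_m,\ m\in\mathbb{N}\}$. Define $\partial:\bigcup_{\ell\ge1}\mathbb{Z}^{2^\ell}\to\mathbb{Z}$ recursively by $\partial(m_1,m_2)=m_2-m_1$ and $\partial(m_1,\dots,m_{2^\ell})=\partial(m_{2^{\ell-1}+1},\dots,m_{2^\ell})-\partial(m_1,\dots,m_{2^{\ell-1}})$ for $\ell>1$. For $r\ge2^\ell$, a set $E\subseteq\mathbb{N}$ is a $\Delta_{\ell,r}$ set if there is an $r$-element sequence $(c_k)_{k=1}^r$ in $\mathbb{Z}$ with $\{\partial(c_{j_1},\dots,c_{j_{2^\ell}}):1\le j_1<\dots<j_{2^\ell}\le r\}\subseteq E$. -}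

module Defs where

open import Data.Nat using (ℕ; zero; suc; _^_; _<_; _≤_)
open import Data.Integer as ℤ using (ℤ; +_)
open import Data.Fin as Fin using (Fin; _↑ˡ_; _↑ʳ_)
open import Data.List using (List; []; map)
open import Data.Nat.ListAction using (sum)
open import Data.List.Membership.Propositional using (_∈_; _∉_)
open import Data.List.Relation.Unary.Unique.Propositional using (Unique)
open import Data.Product using (Σ; _×_; ∃)
open import Data.Sum using (_⊎_)
open import Data.Empty using (⊥)
open import Relation.Binary.PropositionalEquality using (_≡_; _≢_)
open import Function.Bundles using (_⇔_)

-- Sequences are indexed by ℕ starting at 0 (n 0 plays the role of n_1).

record FinSet : Set where
  constructor finset
  field
    elems    : List ℕ
    unique   : Unique elems
    nonempty : elems ≢ []
open FinSet public

ΣS : (ℕ → ℕ) → FinSet → ℕ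
ΣS n α = sum (map n (elems α))

UnionEq : FinSet → FinSet → FinSet → Set
UnionEq α β γ = ∀ x → (x ∈ elems γ) ⇔ (x ∈ elems α ⊎ x ∈ elems β)

Disjoint : FinSet → FinSet → Set
Disjoint α β = ∀ x → x ∈ elems α → x ∉ elems β

FS : (ℕ → ℕ) → ℕ → Set
FS n m = Σ FinSet λ α → ΣS n α ≡ m

-- Halves of a tuple of length 2^(ℓ+1) = 2^ℓ + (2^ℓ + 0)
lo : ∀ {m} → (Fin (m Data.Nat.+ (m Data.Nat.+ 0)) → ℤ) → Fin m → ℤ
lo {m} f i = f (i ↑ˡ (m Data.Nat.+ 0))

hi : ∀ {m} → (Fin (m Data.Nat.+ (m Data.Nat.+ 0)) → ℤ) → Fin m → ℤ
hi {m} f i = f (m ↑ʳ (i ↑ˡ 0))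

-- ∂k k is the paper's ∂ on Z^(2^(k+1)):
--   ∂(m1,m2) = m2 - m1,  ∂(m_1..m_{2^ℓ}) = ∂(second half) - ∂(first half).
∂k : (k : ℕ) → (Fin (2 ^ suc k) → ℤ) → ℤ
∂k zero    f = hi {1} f Fin.zero ℤ.- lo {1} f Fin.zero
∂k (suc k) f = ∂k k (hi {2 ^ suc k} f) ℤ.- ∂k k (lo {2 ^ suc k} f)

StrictlyIncreasing : ∀ {a b} → (Fin a → Fin b) → Set
StrictlyIncreasing j = ∀ x y → x Fin.< y → j x Fin.< j y

-- E is a Δ_{ℓ,r} set (defined for ℓ ≥ 1; the ℓ = 0 case is meaningless and set to ⊥).
-- The side condition r ≥ 2^ℓ is part of the paper's setup, not of the notion itself.
IsΔ : (ℓ r : ℕ) → (ℕ → Set) → Set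
IsΔ zero    r E = ⊥
IsΔ (suc k) r E =
  Σ (Fin r → ℤ) λ c →
    (j : Fin (2 ^ suc k) → Fin r) → StrictlyIncreasing j →
      Σ ℕ λ m → E m × ∂k k (λ i → c (j i)) ≡ + m

-- Write Δₚ_q_s_t = (c_t − c_s) − (c_q − c_p), the value of ∂ on the increasing
-- quadruple p < q < s < t.  If FS(n) were a Δ_{2,8} set, every such value would be
-- a subset sum Σ_{j∈α} n_j, and by uniqueness of sums every additive relation
-- x + y = z between them becomes "x, y disjoint with union z": Δ₂₃₄₆ ⊆ Δ₀₁₃₆ and
-- Δ₁₃₄₅ ⊆ Δ₁₄₆₇, these two supersets are disjoint, so Δ₂₃₄₆ and Δ₁₃₄₅ are disjoint
-- and their union has sum Δ₁₃₄₆ + Δ₂₃₄₅; hence the last two are disjoint,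
-- although Δ₂₃₄₅ ⊆ Δ₁₃₄₆ is non-empty.
-- For larger ℓ, c ↦ (c_{r+i} − c_i)_{i<r} turns a Δ_{ℓ+1,2r} set into a Δ_{ℓ,r}
-- set, and 8·2^{ℓ−2} ≤ 14·2^{ℓ−2}.
module Submission where

open import Defs
open import Data.Nat as ℕ using (ℕ; zero; suc; _+_; _*_; _^_; _∸_; _<_; _≤_; s≤s)
import Data.Nat.Properties as ℕ
open import Algebra.Properties.CommutativeSemigroup ℕ.*-commutativeSemigroup using (x∙yz≈y∙xz)
open import Data.Integer as ℤ using (ℤ; +_)
import Data.Integer.Properties as ℤ
open import Data.Integer.Tactic.RingSolver using (solve-∀)
open import Data.Fin as Fin using (Fin; toℕ; _↑ˡ_; _↑ʳ_; splitAt; inject≤; #_)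
open import Data.Fin.Properties
  using (toℕ-↑ˡ; toℕ-↑ʳ; toℕ<n; toℕ-inject≤; splitAt-↑ˡ; splitAt-↑ʳ; splitAt⁻¹-↑ˡ; splitAt⁻¹-↑ʳ; all?; _<?_)
open import Data.Vec using ([]; _∷_; lookup)
open import Data.List using ([]; _∷_; _++_; map)
open import Data.List.Properties using (map-++; ++-conicalˡ)
open import Data.Nat.ListAction using (sum)
open import Data.Nat.ListAction.Properties using (sum-++)
open import Data.List.Membership.Propositional using (_∈_)
open import Data.List.Relation.Unary.Any using (here)
open import Data.List.Relation.Unary.Unique.Propositional.Properties using (++⁺)
open import Data.Product using (Σ; ∃; _×_; _,_; proj₁; proj₂)
open import Data.Sum using (inj₁; inj₂; [_,_]′)
open import Data.Empty using (⊥; ⊥-elim)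
open import Function using (_∘_)
open import Function.Bundles using (_⇔_; Equivalence)
open import Relation.Binary.PropositionalEquality
  using (_≡_; refl; sym; trans; cong; cong₂; subst; subst₂)
open import Relation.Nullary using (¬_; Dec)
open import Relation.Nullary.Decidable using (True; toWitness; _→-dec_)

variable
  a b m m′ r r′ : ℕ

data SplitView (a b : ℕ) : Fin (a + b) → Set where
  left  : (i : Fin a) → SplitView a b (i ↑ˡ b)
  right : (i : Fin b) → SplitView a b (a ↑ʳ i)

splitView : ∀ a b (x : Fin (a + b)) → SplitView a b x
splitView a b x with splitAt a x in eq
... | inj₁ i = subst (SplitView a b) (splitAt⁻¹-↑ˡ eq) (left i)
... | inj₂ i = subst (SplitView a b) (splitAt⁻¹-↑ʳ eq) (right i)

strictlyIncreasing? : (j : Fin a → Fin b) → Dec (StrictlyIncreasing j)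
strictlyIncreasing? j = all? λ x → all? λ y → (x <? y) →-dec (j x <? j y)

_⊕_ : (Fin a → Fin m) → (Fin b → Fin m′) → Fin (a + b) → Fin (m + m′)
_⊕_ {a} {m} {m′ = m′} f g x = [ (λ i → f i ↑ˡ m′) , (λ i → m ↑ʳ g i) ]′ (splitAt a x)

module _ (f : Fin a → Fin m) (g : Fin b → Fin m′) where

  ⊕-↑ˡ : ∀ i → (f ⊕ g) (i ↑ˡ b) ≡ f i ↑ˡ m′
  ⊕-↑ˡ i rewrite splitAt-↑ˡ a i b = refl

  ⊕-↑ʳ : ∀ i → (f ⊕ g) (a ↑ʳ i) ≡ m ↑ʳ g i
  ⊕-↑ʳ i rewrite splitAt-↑ʳ a b i = refl

  toℕ-⊕-↑ˡ : ∀ i → toℕ ((f ⊕ g) (i ↑ˡ b)) ≡ toℕ (f i)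
  toℕ-⊕-↑ˡ i = trans (cong toℕ (⊕-↑ˡ i)) (toℕ-↑ˡ (f i) m′)

  toℕ-⊕-↑ʳ : ∀ i → toℕ ((f ⊕ g) (a ↑ʳ i)) ≡ m + toℕ (g i)
  toℕ-⊕-↑ʳ i = trans (cong toℕ (⊕-↑ʳ i)) (toℕ-↑ʳ m (g i))

  ⊕-strictlyIncreasing : StrictlyIncreasing f → StrictlyIncreasing g →
                         StrictlyIncreasing (f ⊕ g)
  ⊕-strictlyIncreasing sf sg x y x<y with splitView a b x | splitView a b y
  ... | left i | left i′ =
    subst₂ _<_ (sym (toℕ-⊕-↑ˡ i)) (sym (toℕ-⊕-↑ˡ i′))
      (sf i i′ (subst₂ _<_ (toℕ-↑ˡ i b) (toℕ-↑ˡ i′ b) x<y))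
  ... | left i | right i′ =
    subst₂ _<_ (sym (toℕ-⊕-↑ˡ i)) (sym (toℕ-⊕-↑ʳ i′))
      (ℕ.<-≤-trans (toℕ<n (f i)) (ℕ.m≤m+n m (toℕ (g i′))))
  ... | right i | left i′ =
    ⊥-elim (ℕ.<-asym x<y (subst₂ _<_ (sym (toℕ-↑ˡ i′ b)) (sym (toℕ-↑ʳ a i))
      (ℕ.<-≤-trans (toℕ<n i′) (ℕ.m≤m+n a (toℕ i)))))
  ... | right i | right i′ =
    subst₂ _<_ (sym (toℕ-⊕-↑ʳ i)) (sym (toℕ-⊕-↑ʳ i′))
      (ℕ.+-monoʳ-< m (sg i i′ (ℕ.+-cancelˡ-< a _ _
        (subst₂ _<_ (toℕ-↑ʳ a i) (toℕ-↑ʳ a i′) x<y))))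

-- Two copies of j side by side; 2 * a unfolds to a + (a + 0), matching lo and hi.
double : (Fin a → Fin m) → Fin (2 * a) → Fin (2 * m)
double j = j ⊕ (j ⊕ λ ())

double-strictlyIncreasing : (j : Fin a → Fin m) → StrictlyIncreasing j →
                            StrictlyIncreasing (double j)
double-strictlyIncreasing j sj =
  ⊕-strictlyIncreasing j _ sj (⊕-strictlyIncreasing j (λ ()) sj λ ())

∂k-cong : ∀ k {f g : Fin (2 ^ suc k) → ℤ} → (∀ i → f i ≡ g i) → ∂k k f ≡ ∂k k g
∂k-cong zero    f≗g = cong₂ ℤ._-_ (f≗g _) (f≗g _)
∂k-cong (suc k) f≗g = cong₂ ℤ._-_ (∂k-cong k (f≗g ∘ _)) (∂k-cong k (f≗g ∘ _))

sub-interchange : ∀ (w x y z : ℤ) → (w ℤ.- x) ℤ.- (y ℤ.- z) ≡ (w ℤ.- y) ℤ.- (x ℤ.- z)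
sub-interchange = solve-∀

∂k-sub : ∀ k (f g : Fin (2 ^ suc k) → ℤ) →
         ∂k k (λ i → f i ℤ.- g i) ≡ ∂k k f ℤ.- ∂k k g
∂k-sub zero    f g =
  sub-interchange (hi {1} f Fin.zero) (hi {1} g Fin.zero) (lo {1} f Fin.zero) (lo {1} g Fin.zero)
∂k-sub (suc k) f g = trans
  (cong₂ ℤ._-_ (∂k-sub k (hi f) (hi g)) (∂k-sub k (lo f) (lo g)))
  (sub-interchange (∂k k (hi f)) (∂k k (hi g)) (∂k k (lo f)) (∂k k (lo g)))

∂k-double : ∀ k (c : Fin (2 * m) → ℤ) (j : Fin (2 ^ suc k) → Fin m) →
            ∂k (suc k) (c ∘ double j) ≡ ∂k k (λ i → hi c (j i) ℤ.- lo c (j i))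
∂k-double {m} k c j = sym (trans (∂k-sub k (hi c ∘ j) (lo c ∘ j))
  (cong₂ ℤ._-_ (∂k-cong k (cong c ∘ sym ∘ double-hi))
               (∂k-cong k (cong c ∘ sym ∘ double-lo))))
  where
  M = 2 ^ suc k
  double-lo : ∀ i → double j (i ↑ˡ (M + 0)) ≡ j i ↑ˡ (m + 0)
  double-lo = ⊕-↑ˡ j (j ⊕ λ ())
  double-hi : ∀ i → double j (M ↑ʳ (i ↑ˡ 0)) ≡ m ↑ʳ (j i ↑ˡ 0)
  double-hi i = trans (⊕-↑ʳ j (j ⊕ λ ()) (i ↑ˡ 0)) (cong (m ↑ʳ_) (⊕-↑ˡ j (λ ()) i))

IsΔ-mono : ∀ ℓ {E : ℕ → Set} → r′ ≤ r → IsΔ ℓ r E → IsΔ ℓ r′ E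
IsΔ-mono (suc k) r′≤r (c , δ) =
  (λ i → c (inject≤ i r′≤r)) , λ j sj → δ (λ i → inject≤ (j i) r′≤r) λ x y x<y →
    subst₂ _<_ (sym (toℕ-inject≤ (j x) r′≤r)) (sym (toℕ-inject≤ (j y) r′≤r)) (sj x y x<y)

IsΔ-halve : ∀ k {E : ℕ → Set} → IsΔ (suc (suc k)) (2 * r) E → IsΔ (suc k) r E
IsΔ-halve k (c , δ) = (λ i → hi c i ℤ.- lo c i) , λ j sj →
  let m , Em , ∂≡m = δ (double j) (double-strictlyIncreasing j sj)
  in m , Em , trans (sym (∂k-double k c j)) ∂≡m

IsΔ-collapse : ∀ k {E : ℕ → Set} → IsΔ (suc (suc k)) (r * 2 ^ k) E → IsΔ 2 r E
IsΔ-collapse {r} zero    {E} = subst (λ r → IsΔ 2 r E) (ℕ.*-identityʳ r)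
IsΔ-collapse {r} (suc k) {E} =
  IsΔ-collapse k ∘ IsΔ-halve (suc k)
    ∘ subst (λ r → IsΔ (3 + k) r E) (x∙yz≈y∙xz r 2 (2 ^ k))

quadruple : Fin m → Fin m → Fin m → Fin m → Fin 4 → Fin m
quadruple p q s t = lookup (p ∷ q ∷ s ∷ t ∷ [])

member : (α : FinSet) → ∃ λ x → x ∈ elems α
member (finset []      _ nonempty) = ⊥-elim (nonempty refl)
member (finset (x ∷ _) _ _)        = x , here refl

Δ₂₃₄₆+Δ₀₁₂₄≡Δ₀₁₃₆ : ∀ c₀ c₁ c₂ c₃ c₄ c₆ →
  ((c₆ ℤ.- c₄) ℤ.- (c₃ ℤ.- c₂)) ℤ.+ ((c₄ ℤ.- c₂) ℤ.- (c₁ ℤ.- c₀)) ≡ (c₆ ℤ.- c₃) ℤ.- (c₁ ℤ.- c₀)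
Δ₂₃₄₆+Δ₀₁₂₄≡Δ₀₁₃₆ = solve-∀

Δ₁₃₄₅+Δ₃₅₆₇≡Δ₁₄₆₇ : ∀ c₁ c₃ c₄ c₅ c₆ c₇ →
  ((c₅ ℤ.- c₄) ℤ.- (c₃ ℤ.- c₁)) ℤ.+ ((c₇ ℤ.- c₆) ℤ.- (c₅ ℤ.- c₃)) ≡ (c₇ ℤ.- c₆) ℤ.- (c₄ ℤ.- c₁)
Δ₁₃₄₅+Δ₃₅₆₇≡Δ₁₄₆₇ = solve-∀

Δ₀₁₃₆+Δ₁₄₆₇≡Δ₀₃₄₇ : ∀ c₀ c₁ c₃ c₄ c₆ c₇ →
  ((c₆ ℤ.- c₃) ℤ.- (c₁ ℤ.- c₀)) ℤ.+ ((c₇ ℤ.- c₆) ℤ.- (c₄ ℤ.- c₁)) ≡ (c₇ ℤ.- c₄) ℤ.- (c₃ ℤ.- c₀)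
Δ₀₁₃₆+Δ₁₄₆₇≡Δ₀₃₄₇ = solve-∀

Δ₁₃₄₆+Δ₂₃₄₅≡Δ₂₃₄₆+Δ₁₃₄₅ : ∀ c₁ c₂ c₃ c₄ c₅ c₆ →
  ((c₆ ℤ.- c₄) ℤ.- (c₃ ℤ.- c₁)) ℤ.+ ((c₅ ℤ.- c₄) ℤ.- (c₃ ℤ.- c₂)) ≡
  ((c₆ ℤ.- c₄) ℤ.- (c₃ ℤ.- c₂)) ℤ.+ ((c₅ ℤ.- c₄) ℤ.- (c₃ ℤ.- c₁))
Δ₁₃₄₆+Δ₂₃₄₅≡Δ₂₃₄₆+Δ₁₃₄₅ = solve-∀

Δ₂₃₄₅+Δ₁₂₅₆≡Δ₁₃₄₆ : ∀ c₁ c₂ c₃ c₄ c₅ c₆ →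
  ((c₅ ℤ.- c₄) ℤ.- (c₃ ℤ.- c₂)) ℤ.+ ((c₆ ℤ.- c₅) ℤ.- (c₂ ℤ.- c₁)) ≡ (c₆ ℤ.- c₄) ℤ.- (c₃ ℤ.- c₁)
Δ₂₃₄₅+Δ₁₂₅₆≡Δ₁₃₄₆ = solve-∀

module SubsetSums (n : ℕ → ℕ) where

  infix 4 _+_≐_
  record _+_≐_ (α β γ : FinSet) : Set where
    constructor adds-to
    field sums : ΣS n α + ΣS n β ≡ ΣS n γ

  Represents : ℤ → Set
  Represents p = Σ FinSet λ α → + ΣS n α ≡ p

  represents-+ : ∀ {p q s} (α : Represents p) (β : Represents q) (γ : Represents s) →
                 p ℤ.+ q ≡ s → proj₁ α + proj₁ β ≐ proj₁ γ
  represents-+ (_ , refl) (_ , refl) (_ , refl) = adds-to ∘ ℤ.+-injective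

  represents-+₂ : ∀ {p q s t} (α : Represents p) (β : Represents q) (γ : Represents s) (δ : Represents t) →
                  p ℤ.+ q ≡ s ℤ.+ t →
                  ΣS n (proj₁ α) + ΣS n (proj₁ β) ≡ ΣS n (proj₁ γ) + ΣS n (proj₁ δ)
  represents-+₂ (_ , refl) (_ , refl) (_ , refl) (_ , refl) = ℤ.+-injective

  disjoint-union : (α β : FinSet) → Disjoint α β → Σ FinSet λ γ → ΣS n γ ≡ ΣS n α + ΣS n β
  disjoint-union α β α∩β=∅ =
    finset (elems α ++ elems β)
           (++⁺ (unique α) (unique β) λ (x∈α , x∈β) → α∩β=∅ _ x∈α x∈β)
           (nonempty α ∘ ++-conicalˡ (elems α) (elems β)) ,
    trans (cong sum (map-++ n (elems α) (elems β))) (sum-++ (map n (elems α)) (map n (elems β)))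

module UniqueSums (n : ℕ → ℕ)
  (unique-sums : ∀ α β γ → (ΣS n α + ΣS n β ≡ ΣS n γ) ⇔ (UnionEq α β γ × Disjoint α β))
  where

  open SubsetSums n

  sum-⊆ : ∀ {α β γ} → α + β ≐ γ → ∀ {x} → x ∈ elems α → x ∈ elems γ
  sum-⊆ {α} {β} {γ} (adds-to α+β≡γ) x∈α =
    Equivalence.from (proj₁ (Equivalence.to (unique-sums α β γ) α+β≡γ) _) (inj₁ x∈α)

  sum-disjoint : ∀ {α β γ} → α + β ≐ γ → Disjoint α β
  sum-disjoint {α} {β} {γ} (adds-to α+β≡γ) = proj₂ (Equivalence.to (unique-sums α β γ) α+β≡γ)

  configuration-impossible : ∀ {Y Y′ A Z Z′ B C X W W′} →
    Y + Y′ ≐ A → Z + Z′ ≐ B → A + B ≐ C → ΣS n X + ΣS n W ≡ ΣS n Y + ΣS n Z → W + W′ ≐ X → ⊥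
  configuration-impossible {Y = Y} {Z = Z} {X = X} {W = W} Y⊆A Z⊆B A∩B=∅ X+W≡Y+Z W⊆X =
    X∩W=∅ w (sum-⊆ W⊆X w∈W) w∈W
    where
    Y∩Z=∅ : Disjoint Y Z
    Y∩Z=∅ x x∈Y x∈Z = sum-disjoint A∩B=∅ x (sum-⊆ Y⊆A x∈Y) (sum-⊆ Z⊆B x∈Z)
    Y∪Z = disjoint-union Y Z Y∩Z=∅
    X∩W=∅ : Disjoint X W
    X∩W=∅ = sum-disjoint {X} {W} {proj₁ Y∪Z} (adds-to (trans X+W≡Y+Z (sym (proj₂ Y∪Z))))
    w = proj₁ (member W)
    w∈W = proj₂ (member W)

  ¬IsΔ-2-8 : ¬ IsΔ 2 8 (FS n)
  ¬IsΔ-2-8 (c , δ) = configuration-impossible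
    (represents-+ Δ₂₃₄₆ Δ₀₁₂₄ Δ₀₁₃₆ (Δ₂₃₄₆+Δ₀₁₂₄≡Δ₀₁₃₆ c₀ c₁ c₂ c₃ c₄ c₆))
    (represents-+ Δ₁₃₄₅ Δ₃₅₆₇ Δ₁₄₆₇ (Δ₁₃₄₅+Δ₃₅₆₇≡Δ₁₄₆₇ c₁ c₃ c₄ c₅ c₆ c₇))
    (represents-+ Δ₀₁₃₆ Δ₁₄₆₇ Δ₀₃₄₇ (Δ₀₁₃₆+Δ₁₄₆₇≡Δ₀₃₄₇ c₀ c₁ c₃ c₄ c₆ c₇))
    (represents-+₂ Δ₁₃₄₆ Δ₂₃₄₅ Δ₂₃₄₆ Δ₁₃₄₅
      (Δ₁₃₄₆+Δ₂₃₄₅≡Δ₂₃₄₆+Δ₁₃₄₅ c₁ c₂ c₃ c₄ c₅ c₆))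
    (represents-+ Δ₂₃₄₅ Δ₁₂₅₆ Δ₁₃₄₆ (Δ₂₃₄₅+Δ₁₂₅₆≡Δ₁₃₄₆ c₁ c₂ c₃ c₄ c₅ c₆))
    where
    c₀ = c (# 0); c₁ = c (# 1); c₂ = c (# 2); c₃ = c (# 3)
    c₄ = c (# 4); c₅ = c (# 5); c₆ = c (# 6); c₇ = c (# 7)
    Δ-set : (p q s t : Fin 8) → {True (strictlyIncreasing? (quadruple p q s t))} →
            Represents (∂k 1 (c ∘ quadruple p q s t))
    Δ-set p q s t {increasing} with δ (quadruple p q s t) (toWitness increasing)
    ... | _ , (α , refl) , ∂≡ΣSα = α , sym ∂≡ΣSα
    Δ₀₁₂₄ = Δ-set (# 0) (# 1) (# 2) (# 4)
    Δ₀₁₃₆ = Δ-set (# 0) (# 1) (# 3) (# 6)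
    Δ₀₃₄₇ = Δ-set (# 0) (# 3) (# 4) (# 7)
    Δ₁₂₅₆ = Δ-set (# 1) (# 2) (# 5) (# 6)
    Δ₁₃₄₅ = Δ-set (# 1) (# 3) (# 4) (# 5)
    Δ₁₃₄₆ = Δ-set (# 1) (# 3) (# 4) (# 6)
    Δ₁₄₆₇ = Δ-set (# 1) (# 4) (# 6) (# 7)
    Δ₂₃₄₅ = Δ-set (# 2) (# 3) (# 4) (# 5)
    Δ₂₃₄₆ = Δ-set (# 2) (# 3) (# 4) (# 6)
    Δ₃₅₆₇ = Δ-set (# 3) (# 5) (# 6) (# 7)

theorem8p11 : (n : ℕ → ℕ) → 1 ≤ n 0 → (∀ k → n k < n (suc k)) →
    (∀ α β γ → (ΣS n α + ΣS n β ≡ ΣS n γ) ⇔ (UnionEq α β γ × Disjoint α β)) →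
    ∀ ℓ → 2 ≤ ℓ → ¬ IsΔ ℓ (14 * 2 ^ (ℓ ∸ 2)) (FS n)
theorem8p11 n _ _ unique-sums (suc (suc k)) (s≤s (s≤s _)) =
  UniqueSums.¬IsΔ-2-8 n unique-sums
    ∘ IsΔ-collapse k
    ∘ IsΔ-mono (2 + k) (ℕ.*-monoˡ-≤ (2 ^ k) (ℕ.m≤m+n 8 6))
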